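{- Let $\Sigma$ be a finite nonempty alphabet and let $S = \{x_1, \ldots, x_k\} \subseteq \Sigma^*$ be a finite set with $n = \max_{1 \le i \le k} |x_i| \ge 1$. Then $$\mathrm{sc}(S^*) \le \frac{2}{2|\Sigma| - 1}\left(2^n |\Sigma|^n - 1\right).$$
   Context: For a regular language $L$ over $\Sigma$, $\mathrm{sc}(L)$ is the number of states of the minimal (complete) DFA over $\Sigma$ accepting $L$. -}

module Defs where

open import Data.Nat using (ℕ; zero; suc; _⊔_; _≤_)
open import Data.Fin using (Fin)
open import Data.Bool using (Bool; true)
open import Data.List using (List; []; _∷_; _++_; foldr; map; length)
open import Data.List.Membership.Propositional using (_∈_)
open import Data.Product using (Σ; _×_)
open import Function.Bundles using (_⇔_)
open import Relation.Binary.PropositionalEquality using (_≡_)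

-- The alphabet Σ is Fin m (|Σ| = m); words are lists of letters.
Word : ℕ → Set
Word m = List (Fin m)

Language : ℕ → Set₁
Language m = Word m → Set

-- Kleene star of a finite set S of words (given as a list; duplicates harmless).
data Star {m : ℕ} (S : List (Word m)) : Word m → Set where
  ε-star : Star S []
  cat-star : ∀ {x w} → x ∈ S → Star S w → Star S (x ++ w)

record DFA (m q : ℕ) : Set where
  field
    start  : Fin q
    δ      : Fin q → Fin m → Fin q
    accept : Fin q → Bool

δ* : ∀ {m q} → DFA m q → Fin q → Word m → Fin q
δ* D s []      = s
δ* D s (a ∷ w) = δ* D (DFA.δ D s a) w

Accepts : ∀ {m q} → DFA m q → Word m → Set
Accepts D w = DFA.accept D (δ* D (DFA.start D) w) ≡ true

Recognizes : ∀ {m q} → DFA m q → Language m → Set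
Recognizes {m} D L = (w : Word m) → Accepts D w ⇔ L w

-- n = max length of words in S (0 if S is empty).
maxLen : ∀ {m} → List (Word m) → ℕ
maxLen S = foldr _⊔_ 0 (map length S)

-- A DFA for S* only has to remember whether the input read so far lies in S*,
-- together with its last n − 1 letters, each tagged by whether the prefix
-- preceding it lies in S*. Indeed wa ∈ S* iff wa = p y with p ∈ S*, y ∈ S,
-- y ≠ ε, and then y is a suffix of wa of length at most n, so y = y′a where
-- y′ is among the remembered letters. With |Σ| = m there are
-- 2 · Σ_{i<n} (2m)^i = 2((2m)^n − 1)/(2m − 1) such states.
module Submission where

open import Defs
open import Data.Nat using (ℕ; _*_; _∸_; _^_; _≤_)
open import Data.List using (List)
open import Data.Product using (Σ; _×_)

open import Data.Nat using (zero; suc; _+_; _⊓_; z≤n; s≤s)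
open import Data.Nat.Properties
open import Algebra.Properties.CommutativeSemigroup *-commutativeSemigroup
  using (x∙yz≈y∙xz)
open import Data.Nat.Tactic.RingSolver using (solve-∀)
open import Data.Bool using (Bool; true; false; T; _∧_; _∨_)
open import Data.Bool.Properties using (T-≡; T-∧; T-∨)
open import Data.Empty using (⊥-elim)
open import Data.Fin using (Fin; zero; suc)
open import Data.Fin.Properties using (2↔Bool; *↔×) renaming (_≟_ to _≟ᶠ_)
open import Data.List using ([]; _∷_; _++_; [_]; _∷ʳ_; length; take; foldl; initLast; _∷ʳ′_)
open import Data.List.Properties
  using (++-assoc; ++-identityʳ; length-++; length-take; ∷ʳ-injective; ≡-dec)
open import Data.List.Membership.Propositional using (_∈_)
open import Data.List.Relation.Unary.Any using (here; there)
open import Data.Product as Product using (∃; ∃₂; _,_; proj₁; proj₂)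
open import Data.Product.Function.NonDependent.Propositional using (_×-↪_)
open import Data.Sum as Sum using (_⊎_; inj₁; inj₂)
open import Function using (_∘_)
open import Function.Bundles using (_⇔_; _↪_; mk⇔; mk↪; Equivalence; Inverse; RightInverse)
open import Function.Consequences.Propositional using (strictlyInverseʳ⇒inverseʳ)
open import Function.Construct.Composition using (_↪-∘_; _⇔-∘_)
open import Function.Construct.Identity using (↪-id)
open import Function.Construct.Symmetry using (⇔-sym)
open import Function.Properties.Inverse using (↔-sym; ↔⇒↪)
open import Relation.Binary.PropositionalEquality
  using (_≡_; _≢_; refl; sym; trans; cong; cong₂; subst; module ≡-Reasoning)
open import Relation.Nullary.Decidable using (isYes; toWitness; fromWitness)

listsUpTo : ℕ → ℕ → ℕ
listsUpTo k zero    = 1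
listsUpTo k (suc n) = suc (k * listsUpTo k n)

listsUpTo-geometric : ∀ k n → 1 ≤ k → (k ∸ 1) * listsUpTo k n ≡ k ^ suc n ∸ 1
listsUpTo-geometric (suc j) n _ = begin
  j * listsUpTo (suc j) n          ≡⟨ m+n∸n≡m (j * listsUpTo (suc j) n) 1 ⟨
  j * listsUpTo (suc j) n + 1 ∸ 1  ≡⟨ cong (_∸ 1) (geometric n) ⟩
  suc j ^ suc n ∸ 1                ∎
  where
  open ≡-Reasoning
  geometric : ∀ n → j * listsUpTo (suc j) n + 1 ≡ suc j ^ suc n
  geometric zero    = +-comm (j * 1) 1
  geometric (suc n) = trans (horner j (listsUpTo (suc j) n)) (cong (suc j *_) (geometric n))
    where
    horner : ∀ j L → j * suc (suc j * L) + 1 ≡ suc j * (j * L + 1)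
    horner = solve-∀

List≤ : Set → ℕ → Set
List≤ A n = Σ (List A) λ xs → length xs ≤ n

take≤ : ∀ {A} n → List A → List≤ A n
take≤ n xs = take n xs , subst (_≤ n) (sym (length-take n xs)) (m⊓n≤m n (length xs))

×-↪-Fin : ∀ {A B : Set} {a b} → A ↪ Fin a → B ↪ Fin b → (A × B) ↪ Fin (a * b)
×-↪-Fin f g = ↔⇒↪ (↔-sym *↔×) ↪-∘ (f ×-↪ g)

Bool↪Fin2 : Bool ↪ Fin 2
Bool↪Fin2 = ↔⇒↪ (↔-sym 2↔Bool)

module _ {A : Set} {k : ℕ} (code : A ↪ Fin k) where
  private
    module C = RightInverse code
    module P {L : ℕ} = Inverse (*↔× {k} {L})

  encodeList≤ : ∀ n → List≤ A n → Fin (listsUpTo k n)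
  encodeList≤ zero    _                  = zero
  encodeList≤ (suc n) ([] , _)           = zero
  encodeList≤ (suc n) (x ∷ xs , s≤s len) = suc (P.from (C.to x , encodeList≤ n (xs , len)))

  cons≤ : ∀ {n} → A → List≤ A n → List≤ A (suc n)
  cons≤ x (xs , len) = x ∷ xs , s≤s len

  decodeList≤ : ∀ n → Fin (listsUpTo k n) → List≤ A n
  decodeList≤ zero    _       = [] , z≤n
  decodeList≤ (suc n) zero    = [] , z≤n
  decodeList≤ (suc n) (suc i) = let (c , j) = P.to i in cons≤ (C.from c) (decodeList≤ n j)

  decode-encodeList≤ : ∀ n xs → decodeList≤ n (encodeList≤ n xs) ≡ xs
  decode-encodeList≤ zero    ([] , z≤n)         = refl
  decode-encodeList≤ (suc n) ([] , z≤n)         = refl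
  decode-encodeList≤ (suc n) (x ∷ xs , s≤s len) =
    trans (cong (λ (c , j) → cons≤ (C.from c) (decodeList≤ n j))
                (P.strictlyInverseˡ (C.to x , encodeList≤ n (xs , len))))
          (cong₂ cons≤ (C.strictlyInverseʳ x) (decode-encodeList≤ n (xs , len)))

  List≤-↪-Fin : ∀ n → List≤ A n ↪ Fin (listsUpTo k n)
  List≤-↪-Fin n = mk↪ {from = decodeList≤ n} (strictlyInverseʳ⇒inverseʳ (encodeList≤ n) (decode-encodeList≤ n))

module Encode {m q : ℕ} {A : Set} (code : A ↪ Fin q)
  (start : A) (step : A → Fin m → A) (accepting : A → Bool) where
  open RightInverse code

  dfa : DFA m q
  dfa = record
    { start  = to start
    ; δ      = λ i a → to (step (from i) a)
    ; accept = accepting ∘ from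
    }

  from-δ* : ∀ i w → from (δ* dfa i w) ≡ foldl step (from i) w
  from-δ* i []      = refl
  from-δ* i (a ∷ w) = trans (from-δ* _ w)
    (cong (λ s → foldl step s w) (strictlyInverseʳ (step (from i) a)))

  accept-run : ∀ w → DFA.accept dfa (δ* dfa (DFA.start dfa) w) ≡ accepting (foldl step start w)
  accept-run w = cong accepting
    (trans (from-δ* (to start) w) (cong (λ s → foldl step s w) (strictlyInverseʳ start)))

⊓-suc-⊓ : ∀ m n → m ⊓ suc (m ⊓ n) ≡ m ⊓ suc n
⊓-suc-⊓ m n = trans (sym (⊓-assoc m (suc m) (suc n))) (cong (_⊓ suc n) (m≤n⇒m⊓n≡m (n≤1+n m)))

length-∷ʳ : ∀ {A : Set} (xs : List A) x → length (xs ∷ʳ x) ≡ suc (length xs)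
length-∷ʳ xs x = trans (length-++ xs) (+-comm (length xs) 1)

∷ʳ≢[] : ∀ {A : Set} (xs : List A) x → xs ∷ʳ x ≢ []
∷ʳ≢[] []      x ()
∷ʳ≢[] (_ ∷ _) x ()

++-∷ʳ-split : ∀ {A : Set} (p y : List A) {v a} → p ++ y ≡ v ∷ʳ a → y ≢ [] →
  ∃ λ y′ → y ≡ y′ ∷ʳ a × p ++ y′ ≡ v
++-∷ʳ-split p y {v} eq y≢[] with initLast y
... | []        = ⊥-elim (y≢[] refl)
... | y′ ∷ʳ′ c with ∷ʳ-injective (p ++ y′) v (trans (++-assoc p y′ [ c ]) eq)
...   | p++y′≡v , refl = y′ , refl , p++y′≡v

length≤maxLen : ∀ {m} {S : List (Word m)} {x} → x ∈ S → length x ≤ maxLen S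
length≤maxLen {S = y ∷ S} (here refl) = m≤m⊔n (length y) (maxLen S)
length≤maxLen {S = y ∷ S} (there x∈S) = ≤-trans (length≤maxLen x∈S) (m≤n⊔m (length y) (maxLen S))

module _ {m : ℕ} (S : List (Word m)) where

  Star-snoc : ∀ {p x} → Star S p → x ∈ S → Star S (p ++ x)
  Star-snoc {x = x} ε-star x∈S = subst (Star S) (++-identityʳ x) (cat-star x∈S ε-star)
  Star-snoc {x = x} (cat-star {x₀} {w} x₀∈S p∈S*) x∈S =
    subst (Star S) (sym (++-assoc x₀ w x)) (cat-star x₀∈S (Star-snoc p∈S* x∈S))

  Star-lastFactor : ∀ {z} → Star S z → z ≢ [] →
    ∃₂ λ p y → z ≡ p ++ y × y ∈ S × y ≢ [] × Star S p
  Star-lastFactor ε-star z≢[] = ⊥-elim (z≢[] refl)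
  Star-lastFactor (cat-star {x} {[]} x∈S _) z≢[] =
    [] , x , ++-identityʳ x , x∈S , (λ x≡[] → z≢[] (cong (_++ []) x≡[])) , ε-star
  Star-lastFactor (cat-star {x} {a ∷ w} x∈S w∈S*) _ with Star-lastFactor w∈S* (λ ())
  ... | p , y , w≡py , y∈S , y≢[] , p∈S* =
    x ++ p , y , trans (cong (x ++_) w≡py) (sym (++-assoc x p y)) , y∈S , y≢[] , cat-star x∈S p∈S*

module StarAutomaton {m : ℕ} (S : List (Word m)) (N : ℕ) (maxLen≤ : maxLen S ≤ suc N) where
  open import Data.List.Membership.DecPropositional (≡-dec (_≟ᶠ_ {m})) using (_∈?_)

  Tagged : Set
  Tagged = Bool × Fin m

  State : Set
  State = Bool × List≤ Tagged N

  -- A history of v lists the last letters of v, most recent first, each tagged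
  -- by whether the prefix of v before it lies in S*.
  data History : Word m → List Tagged → Set where
    []   : ∀ {v} → History v []
    snoc : ∀ {v a b l} → (T b ⇔ Star S v) → History v l → History (v ∷ʳ a) ((b , a) ∷ l)

  History-take : ∀ {v l} k → History v l → History v (take k l)
  History-take zero    _          = []
  History-take (suc k) []         = []
  History-take (suc k) (snoc b⇔ h) = snoc b⇔ (History-take k h)

  detect : Word m → List Tagged → Bool
  detect suf []             = false
  detect suf ((b , a) ∷ l) = (b ∧ isYes ((a ∷ suf) ∈? S)) ∨ detect (a ∷ suf) l

  T-detect-∷ : ∀ suf b a l →
    T (detect suf ((b , a) ∷ l)) ⇔ ((T b × a ∷ suf ∈ S) ⊎ T (detect (a ∷ suf) l))
  T-detect-∷ suf b a l =
    mk⇔ (Sum.map₁ (Product.map₂ toWitness ∘ Equivalence.to (T-∧ {b} {a∈?})))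
        (Sum.map₁ (Equivalence.from (T-∧ {b} {a∈?}) ∘ Product.map₂ fromWitness))
    ⇔-∘ T-∨ {b ∧ a∈?} {detect (a ∷ suf) l}
    where
    a∈? = isYes ((a ∷ suf) ∈? S)

  detect-sound : ∀ {v l} suf → History v l → T (detect suf l) →
    ∃₂ λ p y → p ++ y ≡ v × Star S p × y ++ suf ∈ S
  detect-sound suf (snoc {v} {a} {b} {l} b⇔ h) t with Equivalence.to (T-detect-∷ suf b a l) t
  ... | inj₁ (tb , a∈S) = v , [ a ] , refl , Equivalence.to b⇔ tb , a∈S
  ... | inj₂ t′ with detect-sound (a ∷ suf) h t′
  ...   | p , y , p++y≡v , p∈S* , y∈S =
          p , y ∷ʳ a , trans (sym (++-assoc p y [ a ])) (cong (_∷ʳ a) p++y≡v) , p∈S* ,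
          subst (_∈ S) (sym (++-assoc y [ a ] suf)) y∈S

  detect-complete : ∀ {v l} suf p y → History v l → p ++ y ≡ v → Star S p →
    y ++ suf ∈ S → y ≢ [] → length y ≤ length l → T (detect suf l)
  detect-complete suf p []      _ _ _ _ y≢[] _  = ⊥-elim (y≢[] refl)
  detect-complete suf p (_ ∷ _) [] _ _ _ _ ()
  detect-complete suf p y (snoc {a = a} {b} {l} b⇔ h) p++y≡va p∈S* y∈S y≢[] len
    with ++-∷ʳ-split p y p++y≡va y≢[]
  ... | [] , refl , p++[]≡v = Equivalence.from (T-detect-∷ suf b a l)
    (inj₁ (Equivalence.from b⇔ (subst (Star S) (trans (sym (++-identityʳ p)) p++[]≡v) p∈S*) , y∈S))
  ... | y′@(_ ∷ _) , refl , p++y′≡v = Equivalence.from (T-detect-∷ suf b a l)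
    (inj₂ (detect-complete (a ∷ suf) p y′ h p++y′≡v p∈S*
      (subst (_∈ S) (++-assoc y′ [ a ] suf) y∈S) (λ ())
      (≤-pred (subst (_≤ suc (length l)) (length-∷ʳ y′ a) len))))

  start : State
  start = true , [] , z≤n

  step : State → Fin m → State
  step (b , l , _) a = detect [] ((b , a) ∷ l) , take≤ N ((b , a) ∷ l)

  Invariant : Word m → State → Set
  Invariant w (b , l , _) = (T b ⇔ Star S w) × History w l × length l ≡ N ⊓ length w

  invariant-start : Invariant [] start
  invariant-start = mk⇔ (λ _ → ε-star) _ , [] , sym (⊓-zeroʳ N)

  invariant-step : ∀ w s a → Invariant w s → Invariant (w ∷ʳ a) (step s a)
  invariant-step w (b , l , _) a (b⇔ , h , len≡) =
    mk⇔ sound complete , History-take N h′ , length-window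
    where
    h′ : History (w ∷ʳ a) ((b , a) ∷ l)
    h′ = snoc b⇔ h

    sound : T (detect [] ((b , a) ∷ l)) → Star S (w ∷ʳ a)
    sound t with detect-sound [] h′ t
    ... | p , y , p++y≡wa , p∈S* , y∈S =
      subst (Star S) p++y≡wa (Star-snoc S p∈S* (subst (_∈ S) (++-identityʳ y) y∈S))

    -- A last factor y of wa is short enough to be seen in the window.
    complete : Star S (w ∷ʳ a) → T (detect [] ((b , a) ∷ l))
    complete wa∈S* with Star-lastFactor S wa∈S* (∷ʳ≢[] w a)
    ... | p , y , wa≡py , y∈S , y≢[] , p∈S* =
      detect-complete [] p y h′ (sym wa≡py) p∈S* (subst (_∈ S) (sym (++-identityʳ y)) y∈S) y≢[]
        (subst (λ k → length y ≤ suc k) (sym len≡)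
          (⊓-glb (≤-trans (length≤maxLen y∈S) maxLen≤) y≤wa))
      where
      y≤wa : length y ≤ suc (length w)
      y≤wa = begin
        length y           ≤⟨ m≤n+m (length y) (length p) ⟩
        length p + length y ≡⟨ length-++ p ⟨
        length (p ++ y)    ≡⟨ cong length wa≡py ⟨
        length (w ∷ʳ a)    ≡⟨ length-∷ʳ w a ⟩
        suc (length w)     ∎
        where open ≤-Reasoning

    length-window : length (take N ((b , a) ∷ l)) ≡ N ⊓ length (w ∷ʳ a)
    length-window = begin
      length (take N ((b , a) ∷ l)) ≡⟨ length-take N ((b , a) ∷ l) ⟩
      N ⊓ suc (length l)            ≡⟨ cong (λ k → N ⊓ suc k) len≡ ⟩
      N ⊓ suc (N ⊓ length w)        ≡⟨ ⊓-suc-⊓ N (length w) ⟩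
      N ⊓ suc (length w)            ≡⟨ cong (N ⊓_) (length-∷ʳ w a) ⟨
      N ⊓ length (w ∷ʳ a)           ∎
      where open ≡-Reasoning

  invariant-run : ∀ w s v → Invariant w s → Invariant (w ++ v) (foldl step s v)
  invariant-run w s []      i = subst (λ u → Invariant u s) (sym (++-identityʳ w)) i
  invariant-run w s (a ∷ v) i = subst (λ u → Invariant u (foldl step s (a ∷ v))) (++-assoc w [ a ] v)
    (invariant-run (w ∷ʳ a) (step s a) v (invariant-step w s a i))

  stateCode : State ↪ Fin (2 * listsUpTo (2 * m) N)
  stateCode = ×-↪-Fin Bool↪Fin2 (List≤-↪-Fin (×-↪-Fin Bool↪Fin2 (↪-id (Fin m))) N)

  open Encode stateCode start step proj₁ public using (dfa)
  open Encode stateCode start step proj₁ using (accept-run)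

  dfa-recognizes : Recognizes dfa (Star S)
  dfa-recognizes w rewrite accept-run w =
    proj₁ (invariant-run [] start w invariant-start) ⇔-∘ ⇔-sym T-≡

theorem12 : (m : ℕ) → 1 ≤ m → (S : List (Word m)) → 1 ≤ maxLen S →
    Σ ℕ (λ q → ((2 * m ∸ 1) * q ≤ 2 * ((2 * m) ^ maxLen S ∸ 1)) × Σ (DFA m q) (λ D → Recognizes D (Star S)))
theorem12 m 1≤m S _ with maxLen S in maxLen≡
... | suc N = 2 * listsUpTo (2 * m) N , ≤-reflexive bound , dfa , dfa-recognizes
  where
  open StarAutomaton S N (≤-reflexive maxLen≡)
  bound : (2 * m ∸ 1) * (2 * listsUpTo (2 * m) N) ≡ 2 * ((2 * m) ^ suc N ∸ 1)
  bound = trans (x∙yz≈y∙xz (2 * m ∸ 1) 2 (listsUpTo (2 * m) N))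
    (cong (2 *_) (listsUpTo-geometric (2 * m) N (≤-trans 1≤m (m≤n*m m 2))))
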